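{- Let $q,n$ be integers with $q\ge 2$, $n\ge 2$, and suppose $q-1$ divides $qn-1$. Then $\mathsf{id}_{(qn-1)/(q-1)}\le\mathsf{PHP}^{qn}_{n}$ if and only if there exists an $\mathrm{RBIBD}(qn,q,1)$.
   Context: A number $N\ge1$ is identified with $\{0,\dots,N-1\}$. A (finite) problem $\mathsf{P}$ consists of a nonempty finite set of instances and, for each instance $x$, a nonempty finite set $\mathsf{P}(x)$ of solutions. For finite problems $\mathsf{P},\mathsf{Q}$, write $\mathsf{P}\le\mathsf{Q}$ if there exist a map $\Phi$ sending each $\mathsf{P}$-instance $x$ to a $\mathsf{Q}$-instance $\Phi(x)$ and a (partial) map $\Psi$ on $\mathsf{Q}$-solutions such that for every $\mathsf{P}$-instance $x$ and every $y\in\mathsf{Q}(\Phi(x))$, $\Psi(y)\in\mathsf{P}(x)$. For integers $m>n\ge2$, the problem $\mathsf{PHP}^m_n$ has as instances all functions $f:m\to n$, and the solutions to $f$ are all unordered pairs $\{i,j\}\subseteq m$ with $i\ne j$ and $f(i)=f(j)$. For $k\ge1$, the problem $\mathsf{id}_k$ has instances $j\in\{1,\dots,k\}$, each instance $j$ having unique solution $j$. A $\mathrm{BIBD}(p,n,\lambda)$ is a finite set $V$ of $p$ points together with a collection of $n$-element subsets of $V$ (blocks) such that every pair of distinct points lies in exactly $\lambda$ blocks; an $\mathrm{RBIBD}(p,n,\lambda)$ is a $\mathrm{BIBD}(p,n,\lambda)$ whose blocks can be partitioned into parallel classes such that each point lies in exactly one block of each parallel class. -}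

module Defs where

open import Data.Nat using (ℕ; _<_)
open import Data.Fin using (Fin; toℕ)
open import Data.Fin.Subset using (Subset; ∣_∣)
open import Data.Fin.Subset.Properties using (_∈?_)
open import Data.Bool using (Bool; _∧_)
open import Data.Maybe using (Maybe; just)
open import Data.Product using (Σ; Σ-syntax; _×_)
open import Data.Vec using (tabulate)
open import Relation.Nullary using (¬_; does)
open import Relation.Binary.PropositionalEquality using (_≡_)

record Problem : Set₁ where
  field
    Inst : Set
    Sol  : Set
    _solves_ : Sol → Inst → Set
open Problem public

record _≤ᴾ_ (P Q : Problem) : Set where
  field
    Φ : Inst P → Inst Q
    Ψ : Sol Q → Maybe (Sol P)
    correct : (x : Inst P) (y : Sol Q) → _solves_ Q y (Φ x) →
              Σ[ s ∈ Sol P ] (Ψ y ≡ just s × _solves_ P s x)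

-- Unordered pairs {i,j} ⊆ m with i ≠ j, represented canonically as i < j.
UPair : ℕ → Set
UPair m = Σ[ i ∈ Fin m ] Σ[ j ∈ Fin m ] (toℕ i < toℕ j)

PHP : ℕ → ℕ → Problem
PHP m n = record
  { Inst = Fin m → Fin n
  ; Sol = UPair m
  ; _solves_ = λ { (i Data.Product., j Data.Product., _) f → f i ≡ f j }
  }

idP : ℕ → Problem
idP k = record { Inst = Fin k ; Sol = Fin k ; _solves_ = λ s x → s ≡ x }

-- Resolvable BIBD(p, n, λ) on the point set Fin p, with b blocks B i
-- (subsets of Fin p) partitioned into r parallel classes via cls.
record RBIBD (p n lam : ℕ) : Set where
  field
    b r : ℕ
    B   : Fin b → Subset p
    blockSize : ∀ i → ∣ B i ∣ ≡ n
    pairs : ∀ (x y : Fin p) → ¬ x ≡ y →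
            ∣ tabulate (λ i → does (x ∈? B i) ∧ does (y ∈? B i)) ∣ ≡ lam
    cls : Fin b → Fin r
    resolution : ∀ (c : Fin r) (x : Fin p) →
            ∣ tabulate (λ i → does (cls i Data.Fin.≟ c) ∧ does (x ∈? B i)) ∣ ≡ 1

{-# OPTIONS --safe #-}
-- A reduction of id_k to PHP^N_n (N = q n) amounts to k colourings f_x : N → n under which two
-- distinct points share a colour for at most one x, since Ψ must recover x from the collision.
-- Count the triples (x, a, b) with f_x a = f_x b. For fixed x this is the sum of the squared
-- colour-class sizes, at least q N by 2 q s ≤ s² + q², with equality iff every class has size q;
-- for fixed (a, b) it is k if a = b and at most 1 otherwise. Since k (q − 1) = N − 1, both bounds
-- equal k q N, so every colour class has size q and every pair of points collides exactly once:
-- the colour classes are the blocks of an RBIBD(N, q, 1) and the colourings its parallel classes.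
-- Conversely, numbering the n blocks of each parallel class gives such colourings, and counting
-- the blocks through a point shows that there are exactly k parallel classes.

module Submission where

open import Defs
open import Data.Nat
  using (ℕ; zero; suc; _+_; _*_; _∸_; _≤_; _<_; z≤n; s≤s; NonZero; >-nonZero; ∣_-_∣)
open import Function.Bundles using (_⇔_)
open import Relation.Binary.PropositionalEquality using (_≡_)

open import Data.Bool using (Bool; true; false; _∧_)
open import Data.Bool.Properties using (∧-idem)
open import Data.Fin using (Fin; zero; suc; toℕ; cast; combine; remQuot; _↑ˡ_; _↑ʳ_; punchIn)
open import Data.Fin.Properties
  using (_≟_; <-cmp; <⇒≢; toℕ-injective; toℕ-cast; remQuot-combine; punchInᵢ≢i)
  renaming (suc-injective to Fin-suc-injective)
open import Data.Fin.Subset using (Subset; inside; outside; _∈_; ∣_∣; ⁅_⁆; _─_; _⊆_; Nonempty; Empty)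
open import Data.Fin.Subset.Properties
  using (_∈?_; nonempty?; Empty-unique; ∣⊥∣≡0; ∣⁅x⁆∣≡1; x∈⁅x⁆; x∈⁅y⁆⇒x≡y; p⊆q⇒∣p∣≤∣q∣;
         x∈p∧x≢y⇒x∈p-y; p∩q≢∅⇒∣p─q∣<∣p∣; x∈p∩q⁺)
open import Data.Maybe using (Maybe; just)
open import Data.Maybe.Properties using (just-injective)
open import Data.Nat.Properties
  using (≤-reflexive; ≤-trans; ≤-antisym; ≤-total; <-irrefl; +-mono-≤; +-monoˡ-≤; +-monoʳ-≤;
         +-cancelˡ-≤; +-cancelʳ-≤; +-cancelˡ-≡; +-cancelʳ-≡; *-cancelʳ-≡; +-identityʳ; *-identityˡ;
         *-identityʳ; *-zeroʳ; +-assoc; +-comm; *-comm; *-suc; m≤m+n; m≤n⇒∃[o]m+o≡n;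
         ∣m-m+n∣≡n; ∣-∣-comm; ∣m-n∣≡0⇒m≡n; m*n≡0⇒m≡0∨n≡0; +-*-semiring)
open import Data.Nat.Tactic.RingSolver using (solve-∀)
open import Data.Product using (Σ-syntax; _×_; _,_; proj₁; proj₂; uncurry)
open import Data.Sum using (inj₁; inj₂; reduce)
open import Data.Vec using (tabulate; []; _∷_; here; there)
open import Data.Vec.Properties using (lookup∘tabulate; []=⇒lookup; lookup⇒[]=)
open import Function using (_∘_; mk⇔; Equivalence)
open Equivalence using (to; from)
open import Relation.Binary.Definitions using (tri<; tri≈; tri>)
open import Relation.Binary.PropositionalEquality
  using (_≢_; refl; sym; trans; cong; cong₂; subst; subst₂; ≢-sym; module ≡-Reasoning)
open import Relation.Nullary using (yes; no; does; contradiction)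
open import Relation.Nullary.Decidable using (dec-true; dec-false; _×-dec_)
open import Relation.Unary using (Pred; Decidable)

open import Algebra.Properties.Semiring.Sum +-*-semiring
  using (sum-syntax; sum-cong-≗; sum-remove; ∑-comm; ∑-distrib-+; *-distribˡ-sum; *-distribʳ-sum)

open ≡-Reasoning

+-mono-≤-tight : ∀ {a b c d} → a ≤ b → c ≤ d → b + d ≤ a + c → b ≤ a × d ≤ c
+-mono-≤-tight {a} {b} {c} {d} a≤b c≤d b+d≤a+c =
  +-cancelʳ-≤ d b a (≤-trans b+d≤a+c (+-monoʳ-≤ a c≤d)) ,
  +-cancelˡ-≤ b d c (≤-trans b+d≤a+c (+-monoˡ-≤ c a≤b))

s*s+q*q≡2*q*s+gap² : ∀ s q → s * s + q * q ≡ 2 * q * s + ∣ s - q ∣ * ∣ s - q ∣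
s*s+q*q≡2*q*s+gap² s q with ≤-total s q
... | inj₁ s≤q with m≤n⇒∃[o]m+o≡n s≤q
...   | d , refl rewrite ∣m-m+n∣≡n s d = identity s d
  where
  identity : ∀ s d → s * s + (s + d) * (s + d) ≡ 2 * (s + d) * s + d * d
  identity = solve-∀
s*s+q*q≡2*q*s+gap² s q | inj₂ q≤s with m≤n⇒∃[o]m+o≡n q≤s
...   | d , refl rewrite ∣-∣-comm (q + d) q | ∣m-m+n∣≡n q d = identity q d
  where
  identity : ∀ q d → (q + d) * (q + d) + q * q ≡ 2 * q * (q + d) + d * d
  identity = solve-∀

2*q*s≤s*s+q*q : ∀ s q → 2 * q * s ≤ s * s + q * q
2*q*s≤s*s+q*q s q = subst (2 * q * s ≤_) (sym (s*s+q*q≡2*q*s+gap² s q)) (m≤m+n _ _)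

2*q*s≡s*s+q*q⇒s≡q : ∀ s q → 2 * q * s ≡ s * s + q * q → s ≡ q
2*q*s≡s*s+q*q⇒s≡q s q eq = ∣m-n∣≡0⇒m≡n (reduce (m*n≡0⇒m≡0∨n≡0 ∣ s - q ∣ gap²≡0))
  where
  gap²≡0 : ∣ s - q ∣ * ∣ s - q ∣ ≡ 0
  gap²≡0 = +-cancelˡ-≡ (2 * q * s) _ 0
    (trans (sym (s*s+q*q≡2*q*s+gap² s q)) (trans (sym eq) (sym (+-identityʳ _))))

design-equation⇔ : ∀ m q′ N → m * suc q′ + 1 ≡ m + N ⇔ m * q′ + 1 ≡ N
design-equation⇔ m q′ N =
  mk⇔ (λ e → +-cancelˡ-≡ m _ _ (trans (sym expand) e)) (λ e → trans expand (cong (m +_) e))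
  where
  expand : m * suc q′ + 1 ≡ m + (m * q′ + 1)
  expand = trans (cong (_+ 1) (*-suc m q′)) (+-assoc m (m * q′) 1)

design-equation-injective : ∀ q′ .{{_ : NonZero q′}} {r k N} →
  r * suc q′ + 1 ≡ r + N → k * suc q′ + 1 ≡ k + N → r ≡ k
design-equation-injective q′ {r} {k} {N} r-design k-design =
  *-cancelʳ-≡ r k q′ (+-cancelʳ-≡ 1 _ _ (trans (to (design-equation⇔ r q′ N) r-design)
                                               (sym (to (design-equation⇔ k q′ N) k-design))))

⟦_⟧ : Bool → ℕ
⟦ true  ⟧ = 1
⟦ false ⟧ = 0

⟦∧⟧ : ∀ a b → ⟦ a ∧ b ⟧ ≡ ⟦ a ⟧ * ⟦ b ⟧
⟦∧⟧ true  b = sym (*-identityˡ ⟦ b ⟧)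
⟦∧⟧ false b = refl

δ : ∀ {m} → Fin m → Fin m → ℕ
δ i j = ⟦ does (i ≟ j) ⟧

δ-refl : ∀ {m} (i : Fin m) → δ i i ≡ 1
δ-refl i = cong ⟦_⟧ (dec-true (i ≟ i) refl)

δ-≢ : ∀ {m} {i j : Fin m} → i ≢ j → δ i j ≡ 0
δ-≢ {i = i} {j} i≢j = cong ⟦_⟧ (dec-false (i ≟ j) i≢j)

δ-sym : ∀ {m} (i j : Fin m) → δ i j ≡ δ j i
δ-sym i j with i ≟ j
... | yes refl = sym (δ-refl i)
... | no  i≢j  = sym (δ-≢ (≢-sym i≢j))

∑-const : ∀ m c → ∑[ i < m ] c ≡ m * c
∑-const zero    c = refl
∑-const (suc m) c = cong (c +_) (∑-const m c)

∑-mono-≤ : ∀ {m} {f g : Fin m → ℕ} → (∀ i → f i ≤ g i) → ∑[ i < m ] f i ≤ ∑[ i < m ] g i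
∑-mono-≤ {zero}  f≤g = z≤n
∑-mono-≤ {suc m} f≤g = +-mono-≤ (f≤g zero) (∑-mono-≤ (f≤g ∘ suc))

∑-mono-≤-tight : ∀ {m} {f g : Fin m → ℕ} → (∀ i → f i ≤ g i) →
                 ∑[ i < m ] g i ≤ ∑[ i < m ] f i → ∀ i → f i ≡ g i
∑-mono-≤-tight {suc m} f≤g ∑g≤∑f i
  with +-mono-≤-tight (f≤g zero) (∑-mono-≤ (f≤g ∘ suc)) ∑g≤∑f
∑-mono-≤-tight {suc m} f≤g ∑g≤∑f zero    | g₀≤f₀ , _ = ≤-antisym (f≤g zero) g₀≤f₀
∑-mono-≤-tight {suc m} f≤g ∑g≤∑f (suc i) | _ , tail≤ = ∑-mono-≤-tight (f≤g ∘ suc) tail≤ i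

∑∑-mono-≤ : ∀ {m p} {f g : Fin m → Fin p → ℕ} → (∀ i j → f i j ≤ g i j) →
            ∑[ i < m ] ∑[ j < p ] f i j ≤ ∑[ i < m ] ∑[ j < p ] g i j
∑∑-mono-≤ f≤g = ∑-mono-≤ (λ i → ∑-mono-≤ (f≤g i))

∑∑-mono-≤-tight : ∀ {m p} {f g : Fin m → Fin p → ℕ} → (∀ i j → f i j ≤ g i j) →
                  ∑[ i < m ] ∑[ j < p ] g i j ≤ ∑[ i < m ] ∑[ j < p ] f i j → ∀ i j → f i j ≡ g i j
∑∑-mono-≤-tight f≤g ∑∑g≤∑∑f i =
  ∑-mono-≤-tight (f≤g i) (≤-reflexive (sym (∑-mono-≤-tight (λ i → ∑-mono-≤ (f≤g i)) ∑∑g≤∑∑f i)))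

∑-δ : ∀ {m} (i : Fin m) (g : Fin m → ℕ) → ∑[ j < m ] (δ i j * g j) ≡ g i
∑-δ {suc m} i g = begin
  ∑[ j < suc m ] (δ i j * g j)
    ≡⟨ sum-remove {i = i} (λ j → δ i j * g j) ⟩
  δ i i * g i + ∑[ j < m ] (δ i (punchIn i j) * g (punchIn i j))
    ≡⟨ cong₂ _+_ diagonal (sum-cong-≗ off-diagonal) ⟩
  g i + ∑[ j < m ] 0
    ≡⟨ cong (g i +_) (trans (∑-const m 0) (*-zeroʳ m)) ⟩
  g i + 0
    ≡⟨ +-identityʳ (g i) ⟩
  g i ∎
  where
  diagonal : δ i i * g i ≡ g i
  diagonal = trans (cong (_* g i) (δ-refl i)) (*-identityˡ (g i))
  off-diagonal : ∀ j → δ i (punchIn i j) * g (punchIn i j) ≡ 0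
  off-diagonal j = cong (_* g (punchIn i j)) (δ-≢ (≢-sym (punchInᵢ≢i i j)))

∑-δ-const : ∀ {m} (i : Fin m) → ∑[ j < m ] δ i j ≡ 1
∑-δ-const i = trans (sum-cong-≗ (λ j → sym (*-identityʳ (δ i j)))) (∑-δ i (λ _ → 1))

∑-1 : ∀ m → ∑[ i < m ] 1 ≡ m
∑-1 m = trans (∑-const m 1) (*-identityʳ m)

∑-+δ : ∀ {m} (i : Fin m) (g : Fin m → ℕ) → ∑[ j < m ] (g j + δ i j) ≡ ∑[ j < m ] g j + 1
∑-+δ i g = trans (∑-distrib-+ g (δ i)) (cong (∑[ j < _ ] g j +_) (∑-δ-const i))

∑-δ*+1 : ∀ {m} (i : Fin m) c → ∑[ j < m ] (δ i j * c + 1) ≡ c + m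
∑-δ*+1 {m} i c = begin
  ∑[ j < m ] (δ i j * c + 1)            ≡⟨ ∑-distrib-+ (λ j → δ i j * c) (λ _ → 1) ⟩
  ∑[ j < m ] (δ i j * c) + ∑[ j < m ] 1 ≡⟨ cong₂ _+_ (∑-δ i (λ _ → c)) (∑-1 m) ⟩
  c + m                                 ∎

∑-↑ : ∀ m {p} (g : Fin (m + p) → ℕ) →
      ∑[ i < m + p ] g i ≡ ∑[ i < m ] g (i ↑ˡ p) + ∑[ j < p ] g (m ↑ʳ j)
∑-↑ zero    g = refl
∑-↑ (suc m) g = trans (cong (g zero +_) (∑-↑ m (g ∘ suc))) (sym (+-assoc (g zero) _ _))

∑-combine : ∀ k {n} (g : Fin (k * n) → ℕ) → ∑[ i < k * n ] g i ≡ ∑[ x < k ] ∑[ v < n ] g (combine x v)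
∑-combine zero        g = refl
∑-combine (suc k) {n} g =
  trans (∑-↑ n g) (cong (∑[ v < n ] g (v ↑ˡ (k * n)) +_) (∑-combine k (g ∘ (n ↑ʳ_))))

∑-remQuot : ∀ k {n} (g : Fin k × Fin n → ℕ) →
            ∑[ i < k * n ] g (remQuot {k} n i) ≡ ∑[ x < k ] ∑[ v < n ] g (x , v)
∑-remQuot k {n} g = trans (∑-combine k (g ∘ remQuot {k} n))
  (sum-cong-≗ (λ x → sum-cong-≗ (λ v → cong g (remQuot-combine x v))))

∣p∣≡∑∈ : ∀ {m} (p : Subset m) → ∣ p ∣ ≡ ∑[ i < m ] ⟦ does (i ∈? p) ⟧
∣p∣≡∑∈ []            = refl
∣p∣≡∑∈ (inside  ∷ p) = cong suc (∣p∣≡∑∈ p)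
∣p∣≡∑∈ (outside ∷ p) = ∣p∣≡∑∈ p

does-∈?-tabulate : ∀ {m} (h : Fin m → Bool) i → does (i ∈? tabulate h) ≡ h i
does-∈?-tabulate h zero with h zero
... | true  = refl
... | false = refl
does-∈?-tabulate h (suc i) = does-∈?-tabulate (h ∘ suc) i

∣tabulate∣≡∑ : ∀ {m} (h : Fin m → Bool) → ∣ tabulate h ∣ ≡ ∑[ i < m ] ⟦ h i ⟧
∣tabulate∣≡∑ h = trans (∣p∣≡∑∈ (tabulate h)) (sum-cong-≗ (cong ⟦_⟧ ∘ does-∈?-tabulate h))

∈-tabulate⁻ : ∀ {m ℓ} {P : Pred (Fin m) ℓ} (P? : Decidable P) {i} → i ∈ tabulate (does ∘ P?) → P i
∈-tabulate⁻ P? {i} i∈ with P? i | trans (sym (lookup∘tabulate (does ∘ P?) i)) ([]=⇒lookup i∈)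
... | yes Pi | _ = Pi
... | no  _  | ()

∈-tabulate⁺ : ∀ {m ℓ} {P : Pred (Fin m) ℓ} (P? : Decidable P) {i} → P i → i ∈ tabulate (does ∘ P?)
∈-tabulate⁺ P? {i} Pi = lookup⇒[]= i _ (trans (lookup∘tabulate (does ∘ P?) i) (dec-true (P? i) Pi))

Empty⇒∣p∣≡0 : ∀ {m} {p : Subset m} → Empty p → ∣ p ∣ ≡ 0
Empty⇒∣p∣≡0 {m} ¬∃ = trans (cong ∣_∣ (Empty-unique ¬∃)) (∣⊥∣≡0 m)

x∈p⇒1≤∣p∣ : ∀ {m} {p : Subset m} {i} → i ∈ p → 1 ≤ ∣ p ∣
x∈p⇒1≤∣p∣ {p = p} {i} i∈p = subst (_≤ ∣ p ∣) (∣⁅x⁆∣≡1 i) (p⊆q⇒∣p∣≤∣q∣ ⁅i⁆⊆p)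
  where
  ⁅i⁆⊆p : ⁅ i ⁆ ⊆ p
  ⁅i⁆⊆p j∈⁅i⁆ = subst (_∈ p) (sym (x∈⁅y⁆⇒x≡y i j∈⁅i⁆)) i∈p

∣p∣≤1 : ∀ {m} (p : Subset m) → (∀ {i j} → i ∈ p → j ∈ p → i ≡ j) → ∣ p ∣ ≤ 1
∣p∣≤1 p unique with nonempty? p
... | no  ¬∃         = subst (_≤ 1) (sym (Empty⇒∣p∣≡0 ¬∃)) z≤n
... | yes (i , i∈p) = subst (∣ p ∣ ≤_) (∣⁅x⁆∣≡1 i) (p⊆q⇒∣p∣≤∣q∣ p⊆⁅i⁆)
  where
  p⊆⁅i⁆ : p ⊆ ⁅ i ⁆
  p⊆⁅i⁆ j∈p = subst (_∈ ⁅ i ⁆) (unique i∈p j∈p) (x∈⁅x⁆ i)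

∣p∣≡1⇒Nonempty : ∀ {m} (p : Subset m) → ∣ p ∣ ≡ 1 → Nonempty p
∣p∣≡1⇒Nonempty p ∣p∣≡1 with nonempty? p
... | yes ∃ = ∃
... | no ¬∃ = contradiction (trans (sym ∣p∣≡1) (Empty⇒∣p∣≡0 ¬∃)) λ ()

∣p∣≡1⇒unique : ∀ {m} (p : Subset m) → ∣ p ∣ ≡ 1 → ∀ {i j} → i ∈ p → j ∈ p → i ≡ j
∣p∣≡1⇒unique p ∣p∣≡1 {i} {j} i∈p j∈p with i ≟ j
... | yes i≡j = i≡j
... | no  i≢j =
  contradiction (subst (2 ≤_) ∣p∣≡1 (≤-trans (s≤s (x∈p⇒1≤∣p∣ j∈p-i)) ∣p-i∣<∣p∣)) (<-irrefl refl)
  where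
  j∈p-i : j ∈ p ─ ⁅ i ⁆
  j∈p-i = x∈p∧x≢y⇒x∈p-y j∈p (≢-sym i≢j)
  ∣p-i∣<∣p∣ : ∣ p ─ ⁅ i ⁆ ∣ < ∣ p ∣
  ∣p-i∣<∣p∣ = p∩q≢∅⇒∣p─q∣<∣p∣ p ⁅ i ⁆ (i , x∈p∩q⁺ (i∈p , x∈⁅x⁆ i))

rank : ∀ {m} (p : Subset m) {i} → i ∈ p → Fin ∣ p ∣
rank (inside  ∷ p) here        = zero
rank (inside  ∷ p) (there i∈p) = suc (rank p i∈p)
rank (outside ∷ p) (there i∈p) = rank p i∈p

rank-injective : ∀ {m} (p : Subset m) {i j} (i∈p : i ∈ p) (j∈p : j ∈ p) →
                 rank p i∈p ≡ rank p j∈p → i ≡ j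
rank-injective (inside  ∷ p) here        here        _ = refl
rank-injective (inside  ∷ p) (there i∈p) (there j∈p) e =
  cong suc (rank-injective p i∈p j∈p (Fin-suc-injective e))
rank-injective (outside ∷ p) (there i∈p) (there j∈p) e = cong suc (rank-injective p i∈p j∈p e)

cast-injective : ∀ {m p} .(e : m ≡ p) {i j : Fin m} → cast e i ≡ cast e j → i ≡ j
cast-injective e {i} {j} eq =
  toℕ-injective (trans (sym (toℕ-cast e i)) (trans (cong toℕ eq) (toℕ-cast e j)))

-- From a reduction to a resolvable design

CollideAtMostOnce : ∀ {k N n} → (Fin k → Fin N → Fin n) → Set
CollideAtMostOnce f = ∀ {a b} → a ≢ b → ∀ {x y} → f x a ≡ f x b → f y a ≡ f y b → x ≡ y

solution-determines-instance : ∀ {k N n} (red : idP k ≤ᴾ PHP N n) (s : UPair N) {x y} →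
  _solves_ (PHP N n) s (_≤ᴾ_.Φ red x) → _solves_ (PHP N n) s (_≤ᴾ_.Φ red y) → x ≡ y
solution-determines-instance red s {x} {y} sx sy
  with _≤ᴾ_.correct red x s sx | _≤ᴾ_.correct red y s sy
... | _ , Ψs≡x , refl | _ , Ψs≡y , refl = just-injective (trans (sym Ψs≡x) Ψs≡y)

reduction⇒CollideAtMostOnce : ∀ {k N n} (red : idP k ≤ᴾ PHP N n) → CollideAtMostOnce (_≤ᴾ_.Φ red)
reduction⇒CollideAtMostOnce red {a} {b} a≢b fx fy with <-cmp a b
... | tri< a<b _   _   = solution-determines-instance red (a , b , a<b) fx fy
... | tri≈ _   a≡b _   = contradiction a≡b a≢b
... | tri> _   _   b<a = solution-determines-instance red (b , a , b<a) (sym fx) (sym fy)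

module Colourings {k N n : ℕ} (f : Fin k → Fin N → Fin n) where

  fibre : Fin k → Fin n → Subset N
  fibre x v = tabulate (λ a → does (f x a ≟ v))

  block : Fin (k * n) → Subset N
  block i = uncurry fibre (remQuot {k} n i)

  class : Fin (k * n) → Fin k
  class i = proj₁ (remQuot {k} n i)

  fibreSize : Fin k → Fin n → ℕ
  fibreSize x v = ∑[ a < N ] δ (f x a) v

  coincidences : Fin N → Fin N → ℕ
  coincidences a b = ∑[ x < k ] δ (f x a) (f x b)

  ∑-fibreSize : ∀ x → ∑[ v < n ] fibreSize x v ≡ N
  ∑-fibreSize x = begin
    ∑[ v < n ] ∑[ a < N ] δ (f x a) v ≡⟨ ∑-comm (λ v a → δ (f x a) v) ⟩
    ∑[ a < N ] ∑[ v < n ] δ (f x a) v ≡⟨ sum-cong-≗ (λ a → ∑-δ-const (f x a)) ⟩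
    ∑[ a < N ] 1                       ≡⟨ ∑-1 N ⟩
    N                                  ∎

  ∑-fibreSize² : ∀ x → ∑[ v < n ] (fibreSize x v * fibreSize x v) ≡ ∑[ a < N ] fibreSize x (f x a)
  ∑-fibreSize² x = begin
    ∑[ v < n ] (fibreSize x v * fibreSize x v)
      ≡⟨ sum-cong-≗ (λ v → *-distribʳ-sum (fibreSize x v) (λ a → δ (f x a) v)) ⟩
    ∑[ v < n ] ∑[ a < N ] (δ (f x a) v * fibreSize x v)
      ≡⟨ ∑-comm (λ v a → δ (f x a) v * fibreSize x v) ⟩
    ∑[ a < N ] ∑[ v < n ] (δ (f x a) v * fibreSize x v)
      ≡⟨ sum-cong-≗ (λ a → ∑-δ (f x a) (fibreSize x)) ⟩
    ∑[ a < N ] fibreSize x (f x a)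
      ∎

  ∑∑fibreSize²≡∑∑coincidences :
    ∑[ x < k ] ∑[ v < n ] (fibreSize x v * fibreSize x v) ≡ ∑[ a < N ] ∑[ b < N ] coincidences a b
  ∑∑fibreSize²≡∑∑coincidences = begin
    ∑[ x < k ] ∑[ v < n ] (fibreSize x v * fibreSize x v)
      ≡⟨ sum-cong-≗ ∑-fibreSize² ⟩
    ∑[ x < k ] ∑[ a < N ] ∑[ b < N ] δ (f x b) (f x a)
      ≡⟨ ∑-comm (λ x a → ∑[ b < N ] δ (f x b) (f x a)) ⟩
    ∑[ a < N ] ∑[ x < k ] ∑[ b < N ] δ (f x b) (f x a)
      ≡⟨ sum-cong-≗ (λ a → ∑-comm (λ x b → δ (f x b) (f x a))) ⟩
    ∑[ a < N ] ∑[ b < N ] coincidences b a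
      ≡⟨ ∑-comm (λ a b → coincidences b a) ⟩
    ∑[ b < N ] ∑[ a < N ] coincidences b a
      ∎

  coincidences-diagonal : ∀ a → coincidences a a ≡ k
  coincidences-diagonal a = trans (sum-cong-≗ (λ x → δ-refl (f x a))) (∑-1 k)

  coincidences≤1 : CollideAtMostOnce f → ∀ {a b} → a ≢ b → coincidences a b ≤ 1
  coincidences≤1 once {a} {b} a≢b = subst (_≤ 1) (∣tabulate∣≡∑ (does ∘ collide?))
    (∣p∣≤1 _ (λ x∈ y∈ → once a≢b (∈-tabulate⁻ collide? x∈) (∈-tabulate⁻ collide? y∈)))
    where
    collide? : Decidable (λ x → f x a ≡ f x b)
    collide? x = f x a ≟ f x b

  -- Written with δ a b on both sides so that it can be summed over b without truncated subtraction.
  coincidences-bound : CollideAtMostOnce f → ∀ a b → coincidences a b + δ a b ≤ δ a b * k + 1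
  coincidences-bound once a b with a ≟ b
  ... | yes refl = ≤-reflexive (cong (_+ 1) (trans (coincidences-diagonal a) (sym (+-identityʳ k))))
  ... | no  a≢b  = subst (_≤ 1) (sym (+-identityʳ _)) (coincidences≤1 once a≢b)

  does-∈?-fibre : ∀ a x v → does (a ∈? fibre x v) ≡ does (f x a ≟ v)
  does-∈?-fibre a x v = does-∈?-tabulate (λ c → does (f x c ≟ v)) a

  point-in-one-block-per-class : ∀ c a →
                                 ∣ tabulate (λ i → does (class i ≟ c) ∧ does (a ∈? block i)) ∣ ≡ 1
  point-in-one-block-per-class c a = begin
    ∣ tabulate (λ i → does (class i ≟ c) ∧ does (a ∈? block i)) ∣
      ≡⟨ ∣tabulate∣≡∑ (λ i → does (class i ≟ c) ∧ does (a ∈? block i)) ⟩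
    ∑[ i < k * n ] ⟦ does (class i ≟ c) ∧ does (a ∈? block i) ⟧
      ≡⟨ ∑-remQuot k (λ p → ⟦ does (proj₁ p ≟ c) ∧ does (a ∈? uncurry fibre p) ⟧) ⟩
    ∑[ x < k ] ∑[ v < n ] ⟦ does (x ≟ c) ∧ does (a ∈? fibre x v) ⟧
      ≡⟨ sum-cong-≗ (λ x → sum-cong-≗ (λ v → indicator x v)) ⟩
    ∑[ x < k ] ∑[ v < n ] (δ x c * δ (f x a) v)
      ≡⟨ sum-cong-≗ (λ x → sym (*-distribˡ-sum (δ x c) (δ (f x a)))) ⟩
    ∑[ x < k ] (δ x c * ∑[ v < n ] δ (f x a) v)
      ≡⟨ sum-cong-≗ (λ x → cong₂ _*_ (δ-sym x c) (∑-δ-const (f x a))) ⟩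
    ∑[ x < k ] (δ c x * 1)
      ≡⟨ ∑-δ c (λ _ → 1) ⟩
    1 ∎
    where
    indicator : ∀ x v → ⟦ does (x ≟ c) ∧ does (a ∈? fibre x v) ⟧ ≡ δ x c * δ (f x a) v
    indicator x v = trans (cong (λ t → ⟦ does (x ≟ c) ∧ t ⟧) (does-∈?-fibre a x v))
                          (⟦∧⟧ (does (x ≟ c)) (does (f x a ≟ v)))

  module _ {q : ℕ} (N≡q*n : N ≡ q * n) (design : k * q + 1 ≡ k + N) (once : CollideAtMostOnce f) where

    collisions : ℕ
    collisions = ∑[ x < k ] ∑[ v < n ] (fibreSize x v * fibreSize x v)

    kqN : ℕ
    kqN = k * (q * N)

    ∑∑-2*q*s : ∑[ x < k ] ∑[ v < n ] (2 * q * fibreSize x v) ≡ kqN + kqN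
    ∑∑-2*q*s = begin
      ∑[ x < k ] ∑[ v < n ] (2 * q * fibreSize x v)
        ≡⟨ sum-cong-≗ (λ x → sym (*-distribˡ-sum (2 * q) (fibreSize x))) ⟩
      ∑[ x < k ] (2 * q * ∑[ v < n ] fibreSize x v)
        ≡⟨ sum-cong-≗ (λ x → cong (2 * q *_) (∑-fibreSize x)) ⟩
      ∑[ x < k ] (2 * q * N)
        ≡⟨ ∑-const k (2 * q * N) ⟩
      k * (2 * q * N)
        ≡⟨ double k q N ⟩
      kqN + kqN
        ∎
      where
      double : ∀ k q N → k * (2 * q * N) ≡ k * (q * N) + k * (q * N)
      double = solve-∀

    ∑∑-s*s+q*q : ∑[ x < k ] ∑[ v < n ] (fibreSize x v * fibreSize x v + q * q) ≡ collisions + kqN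
    ∑∑-s*s+q*q = begin
      ∑[ x < k ] ∑[ v < n ] (fibreSize x v * fibreSize x v + q * q)
        ≡⟨ sum-cong-≗ (λ x → ∑-distrib-+ (λ v → fibreSize x v * fibreSize x v) (λ _ → q * q)) ⟩
      ∑[ x < k ] (∑[ v < n ] (fibreSize x v * fibreSize x v) + ∑[ v < n ] (q * q))
        ≡⟨ ∑-distrib-+ (λ x → ∑[ v < n ] (fibreSize x v * fibreSize x v)) (λ _ → ∑[ v < n ] (q * q)) ⟩
      collisions + ∑[ x < k ] ∑[ v < n ] (q * q)
        ≡⟨ cong (collisions +_) (trans (∑-const k _) (cong (k *_) (∑-const n (q * q)))) ⟩
      collisions + k * (n * (q * q))
        ≡⟨ cong (λ m → collisions + k * m) n*[q*q]≡q*N ⟩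
      collisions + kqN
        ∎
      where
      n*[q*q]≡q*[q*n] : ∀ n q → n * (q * q) ≡ q * (q * n)
      n*[q*q]≡q*[q*n] = solve-∀
      n*[q*q]≡q*N : n * (q * q) ≡ q * N
      n*[q*q]≡q*N = trans (n*[q*q]≡q*[q*n] n q) (cong (q *_) (sym N≡q*n))

    ∑∑-coincidences+δ : ∑[ a < N ] ∑[ b < N ] (coincidences a b + δ a b) ≡ collisions + N
    ∑∑-coincidences+δ = begin
      ∑[ a < N ] ∑[ b < N ] (coincidences a b + δ a b)
        ≡⟨ sum-cong-≗ (λ a → ∑-+δ a (coincidences a)) ⟩
      ∑[ a < N ] (∑[ b < N ] coincidences a b + 1)
        ≡⟨ ∑-distrib-+ (λ a → ∑[ b < N ] coincidences a b) (λ _ → 1) ⟩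
      ∑[ a < N ] ∑[ b < N ] coincidences a b + ∑[ a < N ] 1
        ≡⟨ cong₂ _+_ (sym ∑∑fibreSize²≡∑∑coincidences) (∑-1 N) ⟩
      collisions + N
        ∎

    ∑∑-δ*k+1 : ∑[ a < N ] ∑[ b < N ] (δ a b * k + 1) ≡ kqN + N
    ∑∑-δ*k+1 = begin
      ∑[ a < N ] ∑[ b < N ] (δ a b * k + 1) ≡⟨ sum-cong-≗ (λ a → ∑-δ*+1 {N} a k) ⟩
      ∑[ a < N ] (k + N)                     ≡⟨ ∑-const N (k + N) ⟩
      N * (k + N)                            ≡⟨ cong (N *_) design ⟨
      N * (k * q + 1)                        ≡⟨ expand N k q ⟩
      kqN + N                                ∎
      where
      expand : ∀ N k q → N * (k * q + 1) ≡ k * (q * N) + N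
      expand = solve-∀

    collisions≡kqN : collisions ≡ kqN
    collisions≡kqN = ≤-antisym upper lower
      where
      upper : collisions ≤ kqN
      upper = +-cancelʳ-≤ N collisions kqN
        (subst₂ _≤_ ∑∑-coincidences+δ ∑∑-δ*k+1 (∑∑-mono-≤ (coincidences-bound once)))
      lower : kqN ≤ collisions
      lower = +-cancelʳ-≤ kqN kqN collisions
        (subst₂ _≤_ ∑∑-2*q*s ∑∑-s*s+q*q (∑∑-mono-≤ (λ x v → 2*q*s≤s*s+q*q (fibreSize x v) q)))

    fibreSize≡q : ∀ x v → fibreSize x v ≡ q
    fibreSize≡q x v = 2*q*s≡s*s+q*q⇒s≡q (fibreSize x v) q
      (∑∑-mono-≤-tight (λ x v → 2*q*s≤s*s+q*q (fibreSize x v) q)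
        (≤-reflexive (trans ∑∑-s*s+q*q (trans (cong (_+ kqN) collisions≡kqN) (sym ∑∑-2*q*s)))) x v)

    coincidences≡1 : ∀ {a b} → a ≢ b → coincidences a b ≡ 1
    coincidences≡1 {a} {b} a≢b =
      trans (sym (+-identityʳ _)) (subst (λ d → coincidences a b + d ≡ d * k + 1) (δ-≢ a≢b) tight)
      where
      tight : coincidences a b + δ a b ≡ δ a b * k + 1
      tight = ∑∑-mono-≤-tight (coincidences-bound once)
        (≤-reflexive (trans ∑∑-δ*k+1 (trans (cong (_+ N) (sym collisions≡kqN)) (sym ∑∑-coincidences+δ))))
        a b

    ∣block∣≡q : ∀ i → ∣ block i ∣ ≡ q
    ∣block∣≡q i = trans (∣tabulate∣≡∑ (λ a → does (f (class i) a ≟ proj₂ (remQuot {k} n i))))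
                        (uncurry fibreSize≡q (remQuot {k} n i))

    pair-in-one-block : ∀ a b → a ≢ b →
                        ∣ tabulate (λ i → does (a ∈? block i) ∧ does (b ∈? block i)) ∣ ≡ 1
    pair-in-one-block a b a≢b = begin
      ∣ tabulate (λ i → does (a ∈? block i) ∧ does (b ∈? block i)) ∣
        ≡⟨ ∣tabulate∣≡∑ (λ i → does (a ∈? block i) ∧ does (b ∈? block i)) ⟩
      ∑[ i < k * n ] ⟦ does (a ∈? block i) ∧ does (b ∈? block i) ⟧
        ≡⟨ ∑-remQuot k (λ p → ⟦ does (a ∈? uncurry fibre p) ∧ does (b ∈? uncurry fibre p) ⟧) ⟩
      ∑[ x < k ] ∑[ v < n ] ⟦ does (a ∈? fibre x v) ∧ does (b ∈? fibre x v) ⟧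
        ≡⟨ sum-cong-≗ (λ x → sum-cong-≗ (λ v → indicator x v)) ⟩
      ∑[ x < k ] ∑[ v < n ] (δ (f x a) v * δ (f x b) v)
        ≡⟨ sum-cong-≗ (λ x → ∑-δ (f x a) (δ (f x b))) ⟩
      coincidences b a
        ≡⟨ coincidences≡1 (≢-sym a≢b) ⟩
      1 ∎
      where
      indicator : ∀ x v → ⟦ does (a ∈? fibre x v) ∧ does (b ∈? fibre x v) ⟧ ≡ δ (f x a) v * δ (f x b) v
      indicator x v = trans (cong₂ (λ s t → ⟦ s ∧ t ⟧) (does-∈?-fibre a x v) (does-∈?-fibre b x v))
                            (⟦∧⟧ (does (f x a ≟ v)) (does (f x b ≟ v)))

  collideAtMostOnce⇒RBIBD : ∀ {q} → N ≡ q * n → k * q + 1 ≡ k + N → CollideAtMostOnce f → RBIBD N q 1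
  collideAtMostOnce⇒RBIBD N≡q*n design once = record
    { b = k * n ; r = k ; B = block ; cls = class
    ; blockSize = ∣block∣≡q N≡q*n design once
    ; pairs = pair-in-one-block N≡q*n design once
    ; resolution = point-in-one-block-per-class
    }

-- From a resolvable design to a reduction

module ParallelClasses {N q : ℕ} (D : RBIBD N q 1) where
  open RBIBD D

  classBlocks : Fin r → Subset b
  classBlocks c = tabulate (λ i → does (cls i ≟ c))

  through? : ∀ a a′ → Decidable (λ i → a ∈ B i × a′ ∈ B i)
  through? a a′ i = a ∈? B i ×-dec a′ ∈? B i

  inClassThrough? : ∀ c a → Decidable (λ i → cls i ≡ c × a ∈ B i)
  inClassThrough? c a i = cls i ≟ c ×-dec a ∈? B i

  blocksThrough : Fin N → Fin N → Subset b
  blocksThrough a a′ = tabulate (does ∘ through? a a′)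

  blocksOfClassThrough : Fin r → Fin N → Subset b
  blocksOfClassThrough c a = tabulate (does ∘ inClassThrough? c a)

  pairCount : Fin N → Fin N → ℕ
  pairCount a a′ = ∑[ i < b ] ⟦ does (a ∈? B i) ∧ does (a′ ∈? B i) ⟧

  ∑-blockSize : ∀ i → ∑[ a < N ] ⟦ does (a ∈? B i) ⟧ ≡ q
  ∑-blockSize i = trans (sym (∣p∣≡∑∈ (B i))) (blockSize i)

  ∑-resolution : ∀ c a → ∑[ i < b ] (δ (cls i) c * ⟦ does (a ∈? B i) ⟧) ≡ 1
  ∑-resolution c a = begin
    ∑[ i < b ] (δ (cls i) c * ⟦ does (a ∈? B i) ⟧)
      ≡⟨ sum-cong-≗ (λ i → ⟦∧⟧ (does (cls i ≟ c)) (does (a ∈? B i))) ⟨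
    ∑[ i < b ] ⟦ does (cls i ≟ c) ∧ does (a ∈? B i) ⟧
      ≡⟨ ∣tabulate∣≡∑ (does ∘ inClassThrough? c a) ⟨
    ∣ blocksOfClassThrough c a ∣
      ≡⟨ resolution c a ⟩
    1 ∎

  replication : ∀ a → ∑[ i < b ] ⟦ does (a ∈? B i) ⟧ ≡ r
  replication a = begin
    ∑[ i < b ] ⟦ does (a ∈? B i) ⟧
      ≡⟨ sum-cong-≗ (λ i → ∑-δ (cls i) (λ _ → ⟦ does (a ∈? B i) ⟧)) ⟨
    ∑[ i < b ] ∑[ c < r ] (δ (cls i) c * ⟦ does (a ∈? B i) ⟧)
      ≡⟨ ∑-comm (λ i c → δ (cls i) c * ⟦ does (a ∈? B i) ⟧) ⟩
    ∑[ c < r ] ∑[ i < b ] (δ (cls i) c * ⟦ does (a ∈? B i) ⟧)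
      ≡⟨ sum-cong-≗ (λ c → ∑-resolution c a) ⟩
    ∑[ c < r ] 1
      ≡⟨ ∑-1 r ⟩
    r ∎

  ∣classBlocks∣*q≡N : ∀ c → ∣ classBlocks c ∣ * q ≡ N
  ∣classBlocks∣*q≡N c = begin
    ∣ classBlocks c ∣ * q
      ≡⟨ cong (_* q) (∣tabulate∣≡∑ (λ i → does (cls i ≟ c))) ⟩
    ∑[ i < b ] δ (cls i) c * q
      ≡⟨ *-distribʳ-sum q (λ i → δ (cls i) c) ⟩
    ∑[ i < b ] (δ (cls i) c * q)
      ≡⟨ sum-cong-≗ (λ i → cong (δ (cls i) c *_) (∑-blockSize i)) ⟨
    ∑[ i < b ] (δ (cls i) c * ∑[ a < N ] ⟦ does (a ∈? B i) ⟧)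
      ≡⟨ sum-cong-≗ (λ i → *-distribˡ-sum (δ (cls i) c) (λ a → ⟦ does (a ∈? B i) ⟧)) ⟩
    ∑[ i < b ] ∑[ a < N ] (δ (cls i) c * ⟦ does (a ∈? B i) ⟧)
      ≡⟨ ∑-comm (λ i a → δ (cls i) c * ⟦ does (a ∈? B i) ⟧) ⟩
    ∑[ a < N ] ∑[ i < b ] (δ (cls i) c * ⟦ does (a ∈? B i) ⟧)
      ≡⟨ sum-cong-≗ (∑-resolution c) ⟩
    ∑[ a < N ] 1
      ≡⟨ ∑-1 N ⟩
    N ∎

  classSize : ∀ {n} → N ≡ q * n → .{{_ : NonZero q}} → ∀ c → ∣ classBlocks c ∣ ≡ n
  classSize {n} N≡q*n c = *-cancelʳ-≡ _ n q (trans (∣classBlocks∣*q≡N c) (trans N≡q*n (*-comm q n)))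

  ∑-pairCount : ∀ a → ∑[ a′ < N ] pairCount a a′ ≡ r * q
  ∑-pairCount a = begin
    ∑[ a′ < N ] ∑[ i < b ] ⟦ does (a ∈? B i) ∧ does (a′ ∈? B i) ⟧
      ≡⟨ sum-cong-≗ (λ a′ → sum-cong-≗ (λ i → ⟦∧⟧ (does (a ∈? B i)) (does (a′ ∈? B i)))) ⟩
    ∑[ a′ < N ] ∑[ i < b ] (⟦ does (a ∈? B i) ⟧ * ⟦ does (a′ ∈? B i) ⟧)
      ≡⟨ ∑-comm (λ a′ i → ⟦ does (a ∈? B i) ⟧ * ⟦ does (a′ ∈? B i) ⟧) ⟩
    ∑[ i < b ] ∑[ a′ < N ] (⟦ does (a ∈? B i) ⟧ * ⟦ does (a′ ∈? B i) ⟧)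
      ≡⟨ sum-cong-≗ (λ i → *-distribˡ-sum ⟦ does (a ∈? B i) ⟧ (λ a′ → ⟦ does (a′ ∈? B i) ⟧)) ⟨
    ∑[ i < b ] (⟦ does (a ∈? B i) ⟧ * ∑[ a′ < N ] ⟦ does (a′ ∈? B i) ⟧)
      ≡⟨ sum-cong-≗ (λ i → cong (⟦ does (a ∈? B i) ⟧ *_) (∑-blockSize i)) ⟩
    ∑[ i < b ] (⟦ does (a ∈? B i) ⟧ * q)
      ≡⟨ *-distribʳ-sum q (λ i → ⟦ does (a ∈? B i) ⟧) ⟨
    ∑[ i < b ] ⟦ does (a ∈? B i) ⟧ * q
      ≡⟨ cong (_* q) (replication a) ⟩
    r * q ∎

  pairCount+δ : ∀ a a′ → pairCount a a′ + δ a a′ ≡ δ a a′ * r + 1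
  pairCount+δ a a′ with a ≟ a′
  ... | yes refl = cong (_+ 1) (trans pairCount-diagonal (sym (+-identityʳ r)))
    where
    pairCount-diagonal : pairCount a a ≡ r
    pairCount-diagonal = trans (sum-cong-≗ (λ i → cong ⟦_⟧ (∧-idem (does (a ∈? B i))))) (replication a)
  ... | no  a≢a′ =
    trans (+-identityʳ _) (trans (sym (∣tabulate∣≡∑ (does ∘ through? a a′))) (pairs a a′ a≢a′))

  replication-equation : Fin N → r * q + 1 ≡ r + N
  replication-equation a = begin
    r * q + 1                              ≡⟨ cong (_+ 1) (∑-pairCount a) ⟨
    ∑[ a′ < N ] pairCount a a′ + 1         ≡⟨ ∑-+δ a (pairCount a) ⟨
    ∑[ a′ < N ] (pairCount a a′ + δ a a′)  ≡⟨ sum-cong-≗ (pairCount+δ a) ⟩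
    ∑[ a′ < N ] (δ a a′ * r + 1)           ≡⟨ ∑-δ*+1 a r ⟩
    r + N                                  ∎

  blockOf : Fin r → Fin N → Fin b
  blockOf c a = proj₁ (∣p∣≡1⇒Nonempty (blocksOfClassThrough c a) (resolution c a))

  blockOf-spec : ∀ c a → cls (blockOf c a) ≡ c × a ∈ B (blockOf c a)
  blockOf-spec c a = ∈-tabulate⁻ (inClassThrough? c a)
    (proj₂ (∣p∣≡1⇒Nonempty (blocksOfClassThrough c a) (resolution c a)))

  blockOf∈classBlocks : ∀ c a → blockOf c a ∈ classBlocks c
  blockOf∈classBlocks c a = ∈-tabulate⁺ (λ i → cls i ≟ c) (proj₁ (blockOf-spec c a))

  blockThrough : ∀ {a a′} → a ≢ a′ → Fin b
  blockThrough {a} {a′} a≢a′ = proj₁ (∣p∣≡1⇒Nonempty (blocksThrough a a′) (pairs a a′ a≢a′))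

  blockThrough-unique : ∀ {a a′ i} (a≢a′ : a ≢ a′) → a ∈ B i → a′ ∈ B i → blockThrough a≢a′ ≡ i
  blockThrough-unique {a} {a′} a≢a′ a∈Bi a′∈Bi = ∣p∣≡1⇒unique (blocksThrough a a′) (pairs a a′ a≢a′)
    (proj₂ (∣p∣≡1⇒Nonempty (blocksThrough a a′) (pairs a a′ a≢a′)))
    (∈-tabulate⁺ (through? a a′) (a∈Bi , a′∈Bi))

  RBIBD⇒reduction : ∀ {n} → N ≡ q * n → .{{_ : NonZero q}} → idP r ≤ᴾ PHP N n
  RBIBD⇒reduction {n} N≡q*n = record { Φ = colour ; Ψ = classOfPair ; correct = correct }
    where
    colour : Fin r → Fin N → Fin n
    colour c a = cast (classSize N≡q*n c) (rank (classBlocks c) (blockOf∈classBlocks c a))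

    classOfPair : UPair N → Maybe (Fin r)
    classOfPair (a , a′ , a<a′) = just (cls (blockThrough (<⇒≢ a<a′)))

    correct : ∀ c (s : UPair N) → _solves_ (PHP N n) s (colour c) →
              Σ[ c′ ∈ Fin r ] (classOfPair s ≡ just c′ × c′ ≡ c)
    correct c (a , a′ , a<a′) same-colour = c , cong just cls≡c , refl
      where
      same-block : blockOf c a ≡ blockOf c a′
      same-block = rank-injective (classBlocks c) _ _ (cast-injective (classSize N≡q*n c) same-colour)
      a′∈block : a′ ∈ B (blockOf c a)
      a′∈block = subst (λ i → a′ ∈ B i) (sym same-block) (proj₂ (blockOf-spec c a′))
      cls≡c : cls (blockThrough (<⇒≢ a<a′)) ≡ c
      cls≡c = trans (cong cls (blockThrough-unique (<⇒≢ a<a′) (proj₂ (blockOf-spec c a)) a′∈block))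
                    (proj₁ (blockOf-spec c a))

theorem2p15 : (q n : ℕ) → 2 ≤ q → 2 ≤ n → (k : ℕ) → (q ∸ 1) * k ≡ q * n ∸ 1 →
    (idP k ≤ᴾ PHP (q * n) n) ⇔ RBIBD (q * n) q 1
theorem2p15 (suc q′) (suc n′) (s≤s 1≤q′) (s≤s _) k q′*k≡N∸1 = mk⇔ to-design from-design
  where
  N = suc q′ * suc n′
  -- N is a successor by computation, so suc (N ∸ 1) is N.
  design : k * suc q′ + 1 ≡ k + N
  design = from (design-equation⇔ k q′ N)
    (trans (cong (_+ 1) (*-comm k q′)) (trans (+-comm _ 1) (cong suc q′*k≡N∸1)))

  to-design : idP k ≤ᴾ PHP N (suc n′) → RBIBD N (suc q′) 1
  to-design red =
    Colourings.collideAtMostOnce⇒RBIBD (_≤ᴾ_.Φ red) refl design (reduction⇒CollideAtMostOnce red)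

  from-design : RBIBD N (suc q′) 1 → idP k ≤ᴾ PHP N (suc n′)
  from-design D = subst (λ r → idP r ≤ᴾ PHP N (suc n′)) r≡k (RBIBD⇒reduction refl)
    where
    open ParallelClasses D
    r≡k : RBIBD.r D ≡ k
    r≡k = design-equation-injective q′ {{>-nonZero 1≤q′}} (replication-equation zero) design
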